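{- For every $n>1$, $$L'_n(x,y)=y\,L_{n-1}(x,y+1)\qquad\text{and}\qquad L_n(x,y)=L'_n(x,y)+\sum_{p=1}^{n-1}L'_p(x,y)\,L_{n-p}(x,y).$$
   Context: A Dyck path is a word over $\{a,b\}$ with equally many $a$'s and $b$'s such that every prefix has at least as many $a$'s as $b$'s; it is primitive if it is nonempty and not the concatenation of two nonempty Dyck paths. $D_n$ (resp. $D'_n$) is the set of Dyck paths (resp. primitive Dyck paths) of length $2n$. For a word $g$, $|g|_a,|g|_b$ denote its numbers of $a$'s and $b$'s. For a Dyck path $w$, $L(w)\in\mathbb Z[x,y]$ is the product, over all occurrences of $b$ in $w$ (writing $w=w'bw''$), of $x$ if $w'$ ends with $a$, and of $y+h$ with $h=|w'b|_a-|w'b|_b$ otherwise. $L_n=\sum_{w\in D_n}L(w)$ and $L'_n=\sum_{w\in D'_n}L(w)$ (so $L_1=L'_1=x$). -}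

module Defs where

open import Level using (Level)
open import Data.Bool using (Bool; true; false; if_then_else_)
open import Data.Nat as ℕ using (ℕ; zero; suc; _∸_)
open import Data.Nat.Properties using (_≤?_; _≟_)
open import Data.Integer as ℤ using (ℤ; +_; -[1+_])
open import Data.List using (List; []; _∷_; _++_; [_]; map; filter; foldr; concatMap; upTo; length)
open import Data.List.Relation.Unary.All using (All; all?)
open import Data.List.Relation.Unary.Any using (Any; any?)
open import Data.Product using (_×_; _,_; proj₁; proj₂)
open import Relation.Nullary using (¬_; Dec; yes; no)
open import Relation.Nullary.Decidable using (_×-dec_; ¬?)
open import Algebra.Bundles using (CommutativeRing)

data Letter : Set where
  a b : Letter

Word : Set
Word = List Letter

count : Letter → Word → ℕ
count ℓ [] = 0
count a (a ∷ w) = suc (count a w)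
count a (b ∷ w) = count a w
count b (a ∷ w) = count b w
count b (b ∷ w) = suc (count b w)

splits : Word → List (Word × Word)
splits [] = ([] , []) ∷ []
splits (c ∷ w) = ([] , c ∷ w) ∷ map (λ p → (c ∷ proj₁ p , proj₂ p)) (splits w)

prefixes : Word → List Word
prefixes w = map proj₁ (splits w)

NonEmpty : Word → Set
NonEmpty w = 0 ℕ.< length w

IsDyck : Word → Set
IsDyck w = (count a w ≡' count b w) × All (λ u → count b u ℕ.≤ count a u) (prefixes w)
  where
  open import Relation.Binary.PropositionalEquality using () renaming (_≡_ to _≡'_)

isDyck? : (w : Word) → Dec (IsDyck w)
isDyck? w = (count a w ≟ count b w) ×-dec all? (λ u → count b u ≤? count a u) (prefixes w)

IsPrimitive : Word → Set
IsPrimitive w = IsDyck w × NonEmpty w ×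
  ¬ Any (λ p → NonEmpty (proj₁ p) × NonEmpty (proj₂ p) × IsDyck (proj₁ p) × IsDyck (proj₂ p)) (splits w)

isPrimitive? : (w : Word) → Dec (IsPrimitive w)
isPrimitive? w = isDyck? w ×-dec (1 ℕ.≤? length w) ×-dec
  ¬? (any? (λ p → (1 ℕ.≤? length (proj₁ p)) ×-dec (1 ℕ.≤? length (proj₂ p))
                 ×-dec isDyck? (proj₁ p) ×-dec isDyck? (proj₂ p)) (splits w))

words : ℕ → List Word
words zero = [] ∷ []
words (suc m) = concatMap (λ w → (a ∷ w) ∷ (b ∷ w) ∷ []) (words m)

-- D_n and D'_n (as lists, each element occurring once)
D : ℕ → List Word
D n = filter isDyck? (words (2 ℕ.* n))

D' : ℕ → List Word
D' n = filter isPrimitive? (words (2 ℕ.* n))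

endsWithA : Word → Bool
endsWithA [] = false
endsWithA (a ∷ []) = true
endsWithA (b ∷ []) = false
endsWithA (_ ∷ c ∷ w) = endsWithA (c ∷ w)

-- The polynomials L(w), L_n, L'_n in ℤ[x,y], realised by evaluation in an
-- arbitrary commutative ring R at arbitrary x y (universal property of ℤ[x,y]).
module Poly {c ℓ : Level} (R : CommutativeRing c ℓ) where
  open CommutativeRing R

  natR : ℕ → Carrier
  natR zero = 0#
  natR (suc n) = 1# + natR n

  intR : ℤ → Carrier
  intR (+ n) = natR n
  intR -[1+ n ] = - natR (suc n)

  factor : Carrier → Carrier → Word → Carrier
  factor x y w' = if endsWithA w' then x
                  else y + intR (ℤ.+ count a (w' ++ [ b ]) ℤ.- ℤ.+ count b (w' ++ [ b ]))

  Lgo : Carrier → Carrier → Word → Word → Carrier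
  Lgo x y pre [] = 1#
  Lgo x y pre (a ∷ rest) = Lgo x y (pre ++ [ a ]) rest
  Lgo x y pre (b ∷ rest) = factor x y pre * Lgo x y (pre ++ [ b ]) rest

  Lw : Word → Carrier → Carrier → Carrier
  Lw w x y = Lgo x y [] w

  sumR : List Carrier → Carrier
  sumR = foldr _+_ 0#

  L : ℕ → Carrier → Carrier → Carrier
  L n x y = sumR (map (λ w → Lw w x y) (D n))

  L' : ℕ → Carrier → Carrier → Carrier
  L' n x y = sumR (map (λ w → Lw w x y) (D' n))

  sumFrom1 : ℕ → (ℕ → Carrier) → Carrier
  sumFrom1 m f = sumR (map (λ i → f (suc i)) (upTo m))

-- Read a as an up-step and b as a down-step: an occurrence of b contributes x when it follows
-- an a, and y plus the height it reaches otherwise.  For n > 1 a primitive path of length 2n is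
-- a u b with u a nonempty Dyck path run one level higher; its last b follows a b and reaches
-- height 0, so contributes y, and raising every height by one is the same as replacing y by
-- y + 1, whence L'_n(x,y) = y L_{n-1}(x,y+1).  A nonempty Dyck path splits uniquely, at its
-- first return to height 0, into a primitive path followed by a Dyck path, and its weight is
-- the product of theirs because the second piece starts at height 0 after a b, just as a word
-- does at its start.  Summing over all words and all their splits gives the convolution; the
-- terms whose first factor has odd length vanish.
module Submission where

open import Defs
open import Level using (Level)
open import Data.Bool using (Bool; true; false; T; if_then_else_)
open import Data.Bool.Properties using (T?)
open import Data.Empty using (⊥-elim)
open import Data.Nat as ℕ using (ℕ; zero; suc; _<_; _≤_; _∸_; z≤n; s≤s; parity)
open import Data.Nat.Properties using (+-suc; suc-injective; n∸n≡0)
open import Data.Parity.Base using (0ℙ; 1ℙ)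
open import Data.Integer as ℤ using (ℤ; +_; -[1+_])
import Data.Integer.Properties as ℤₚ
open import Data.Integer.Tactic.RingSolver using (solve-∀)
open import Data.List using ([]; _∷_; _++_; [_]; map; null; length; applyUpTo; filter; concatMap)
open import Data.List.Properties using (map-upTo)
open import Data.List.Relation.Unary.All as All using (All; []; _∷_)
import Data.List.Relation.Unary.All.Properties as All
open import Data.List.Relation.Unary.Any using (Any; here; there)
import Data.List.Relation.Unary.Any.Properties as Any
open import Data.Product using (_×_; _,_; proj₁; proj₂; ∃₂)
open import Function using (_∘_)
open import Algebra.Bundles using (CommutativeRing)
open import Relation.Nullary using (¬_; yes; no; does; proof)
open import Relation.Unary using (Decidable)
open import Relation.Nullary.Reflects using (fromEquivalence; det)
open import Relation.Binary.PropositionalEquality using (_≡_; refl; sym; trans; cong; cong₂; subst)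

-- dyckFrom h w: the walk w started at height h ends at height 0 and never goes below it.
-- returnsFrom h w: moreover w is nonempty and its height is positive at every interior point.
dyckFrom : ℕ → Word → Bool
dyckFrom h (a ∷ w) = dyckFrom (suc h) w
dyckFrom zero [] = true
dyckFrom (suc h) [] = false
dyckFrom zero (b ∷ w) = false
dyckFrom (suc h) (b ∷ w) = dyckFrom h w

returnsFrom : ℕ → Word → Bool
returnsFrom h [] = false
returnsFrom h (a ∷ w) = returnsFrom (suc h) w
returnsFrom zero (b ∷ w) = false
returnsFrom (suc zero) (b ∷ w) = null w
returnsFrom (suc (suc h)) (b ∷ w) = returnsFrom (suc h) w

returnsFrom⇒dyckFrom : ∀ h w → T (returnsFrom h w) → T (dyckFrom h w)
returnsFrom⇒dyckFrom h (a ∷ w) r = returnsFrom⇒dyckFrom (suc h) w r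
returnsFrom⇒dyckFrom (suc zero) (b ∷ []) r = r
returnsFrom⇒dyckFrom (suc (suc h)) (b ∷ w) r = returnsFrom⇒dyckFrom (suc h) w r

returnsFrom-snoc-a : ∀ h u → returnsFrom h (u ++ [ a ]) ≡ false
returnsFrom-snoc-a h [] = refl
returnsFrom-snoc-a h (a ∷ u) = returnsFrom-snoc-a (suc h) u
returnsFrom-snoc-a zero (b ∷ u) = refl
returnsFrom-snoc-a (suc zero) (b ∷ []) = refl
returnsFrom-snoc-a (suc zero) (b ∷ _ ∷ _) = refl
returnsFrom-snoc-a (suc (suc h)) (b ∷ u) = returnsFrom-snoc-a (suc h) u

returnsFrom-snoc-b : ∀ h u → returnsFrom (suc h) (u ++ [ b ]) ≡ dyckFrom h u
returnsFrom-snoc-b zero [] = refl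
returnsFrom-snoc-b (suc h) [] = refl
returnsFrom-snoc-b h (a ∷ u) = returnsFrom-snoc-b (suc h) u
returnsFrom-snoc-b zero (b ∷ []) = refl
returnsFrom-snoc-b zero (b ∷ _ ∷ _) = refl
returnsFrom-snoc-b (suc h) (b ∷ u) = returnsFrom-snoc-b h u

returnsFrom-after-dyckFrom : ∀ h u c v → T (dyckFrom (suc h) u) → ¬ T (returnsFrom (suc h) (u ++ c ∷ v))
returnsFrom-after-dyckFrom h (a ∷ u) c v d = returnsFrom-after-dyckFrom (suc h) u c v d
returnsFrom-after-dyckFrom zero (b ∷ []) c v d ()
returnsFrom-after-dyckFrom zero (b ∷ _ ∷ _) c v d ()
returnsFrom-after-dyckFrom (suc h) (b ∷ u) c v d = returnsFrom-after-dyckFrom h u c v d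

dyckFrom-firstReturn : ∀ h w → T (dyckFrom (suc h) w) → ¬ T (returnsFrom (suc h) w) →
  ∃₂ λ u v → u ++ v ≡ w × T (dyckFrom (suc h) u) × T (dyckFrom 0 v) × NonEmpty v
dyckFrom-firstReturn h (a ∷ w) d r with dyckFrom-firstReturn (suc h) w d r
... | u , v , refl , du , dv , nv = a ∷ u , v , refl , du , dv , nv
dyckFrom-firstReturn zero (b ∷ []) d r = ⊥-elim (r _)
dyckFrom-firstReturn zero (b ∷ c ∷ w) d r = b ∷ [] , c ∷ w , refl , _ , d , s≤s z≤n
dyckFrom-firstReturn (suc h) (b ∷ w) d r with dyckFrom-firstReturn h w d r
... | u , v , refl , du , dv , nv = b ∷ u , v , refl , du , dv , nv

double : ℕ → ℕ
double zero = zero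
double (suc n) = suc (suc (double n))

double≡2* : ∀ n → double n ≡ 2 ℕ.* n
double≡2* zero = refl
double≡2* (suc n) = cong suc (trans (cong suc (double≡2* n)) (sym (+-suc n (n ℕ.+ 0))))

double-∸ : ∀ m n → double m ∸ double n ≡ double (m ∸ n)
double-∸ m zero = refl
double-∸ zero (suc n) = refl
double-∸ (suc m) (suc n) = double-∸ m n

dyckFrom-parity : ∀ h w → T (dyckFrom h w) → parity (h ℕ.+ length w) ≡ 0ℙ
dyckFrom-parity zero [] d = refl
dyckFrom-parity h (a ∷ w) d = trans (cong parity (+-suc h (length w))) (dyckFrom-parity (suc h) w d)
dyckFrom-parity (suc h) (b ∷ w) d = trans (cong parity (+-suc (suc h) (length w))) (dyckFrom-parity h w d)

parity-odd : ∀ j → parity (suc (double j)) ≡ 1ℙ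
parity-odd zero = refl
parity-odd (suc j) = parity-odd j

returnsFrom-odd : ∀ j u → length u ≡ suc (double j) → ¬ T (returnsFrom 0 u)
returnsFrom-odd j u ℓ r
  with trans (sym (parity-odd j)) (trans (cong parity (sym ℓ)) (dyckFrom-parity 0 u (returnsFrom⇒dyckFrom 0 u r)))
... | ()

DyckFrom : ℕ → Word → Set
DyckFrom h w = h ℕ.+ count a w ≡ count b w × All (λ u → count b u ≤ h ℕ.+ count a u) (prefixes w)

module _ {P : Word → Set} where

  All-prefixes-[] : ∀ w → All P (prefixes w) → P []
  All-prefixes-[] [] (p ∷ _) = p
  All-prefixes-[] (c ∷ w) (p ∷ _) = p

  All-prefixes⁻ : ∀ c w → All P (prefixes (c ∷ w)) → P [] × All (P ∘ (c ∷_)) (prefixes w)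
  All-prefixes⁻ c w (p ∷ ps) = p , All.map⁺ (All.map⁻ (All.map⁻ ps))

  All-prefixes⁺ : ∀ c w → P [] → All (P ∘ (c ∷_)) (prefixes w) → All P (prefixes (c ∷ w))
  All-prefixes⁺ c w p ps = p ∷ All.map⁺ (All.map⁺ (All.map⁻ ps))

dyckFrom-sound : ∀ h w → T (dyckFrom h w) → DyckFrom h w
dyckFrom-sound zero [] d = refl , z≤n ∷ []
dyckFrom-sound h (a ∷ w) d with dyckFrom-sound (suc h) w d
... | e , bal = trans (+-suc h (count a w)) e ,
  All-prefixes⁺ a w z≤n (All.map (λ {u} p → subst (count b u ≤_) (sym (+-suc h (count a u))) p) bal)
dyckFrom-sound (suc h) (b ∷ w) d with dyckFrom-sound h w d
... | e , bal = cong suc e , All-prefixes⁺ b w z≤n (All.map s≤s bal)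

dyckFrom-complete : ∀ h w → DyckFrom h w → T (dyckFrom h w)
dyckFrom-complete zero [] _ = _
dyckFrom-complete (suc h) [] (() , _)
dyckFrom-complete h (a ∷ w) (e , bal) = dyckFrom-complete (suc h) w
  (trans (sym (+-suc h (count a w))) e ,
   All.map (λ {u} p → subst (count b u ≤_) (+-suc h (count a u)) p) (proj₂ (All-prefixes⁻ a w bal)))
dyckFrom-complete zero (b ∷ w) (_ , bal) with All-prefixes-[] w (proj₂ (All-prefixes⁻ b w bal))
... | ()
dyckFrom-complete (suc h) (b ∷ w) (e , bal) = dyckFrom-complete h w
  (suc-injective e , All.map (λ { (s≤s p) → p }) (proj₂ (All-prefixes⁻ b w bal)))

does-isDyck? : ∀ w → does (isDyck? w) ≡ dyckFrom 0 w
does-isDyck? w = det (proof (isDyck? w)) (fromEquivalence (dyckFrom-sound 0 w) (dyckFrom-complete 0 w))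

Any-splits⁻ : ∀ {P : Word × Word → Set} w → Any P (splits w) → ∃₂ λ u v → u ++ v ≡ w × P (u , v)
Any-splits⁻ [] (here p) = [] , [] , refl , p
Any-splits⁻ (c ∷ w) (here p) = [] , c ∷ w , refl , p
Any-splits⁻ (c ∷ w) (there s) with Any-splits⁻ w (Any.map⁻ s)
... | u , v , refl , p = c ∷ u , v , refl , p

Any-splits⁺ : ∀ {P : Word × Word → Set} u v → P (u , v) → Any P (splits (u ++ v))
Any-splits⁺ [] [] p = here p
Any-splits⁺ [] (c ∷ v) p = here p
Any-splits⁺ (c ∷ u) v p = there (Any.map⁺ (Any-splits⁺ u v p))

returnsFrom-sound : ∀ w → T (returnsFrom 0 w) → IsPrimitive w
returnsFrom-sound (a ∷ w) r = dyckFrom-sound 0 (a ∷ w) (returnsFrom⇒dyckFrom 1 w r) , s≤s z≤n , unsplittable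
  where
  unsplittable : ¬ Any (λ p → NonEmpty (proj₁ p) × NonEmpty (proj₂ p) × IsDyck (proj₁ p) × IsDyck (proj₂ p))
                       (splits (a ∷ w))
  unsplittable s with Any-splits⁻ (a ∷ w) s
  ... | a ∷ u , c ∷ v , refl , _ , _ , du , _ = returnsFrom-after-dyckFrom 0 u c v (dyckFrom-complete 0 (a ∷ u) du) r
  ... | b ∷ u , _ , _ , _ , _ , du , _ = dyckFrom-complete 0 (b ∷ u) du

returnsFrom-complete : ∀ w → IsPrimitive w → T (returnsFrom 0 w)
returnsFrom-complete (a ∷ w) (d , _ , unsplittable) with T? (returnsFrom 1 w)
... | yes r = r
... | no ¬r with dyckFrom-firstReturn 0 w (dyckFrom-complete 0 (a ∷ w) d) ¬r
... | u , v , refl , du , dv , nv = ⊥-elim (unsplittable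
  (Any-splits⁺ (a ∷ u) v (s≤s z≤n , nv , dyckFrom-sound 0 (a ∷ u) du , dyckFrom-sound 0 v dv)))
returnsFrom-complete (b ∷ w) (d , _ , _) = dyckFrom-complete 0 (b ∷ w) d

does-isPrimitive? : ∀ w → does (isPrimitive? w) ≡ returnsFrom 0 w
does-isPrimitive? w = det (proof (isPrimitive? w)) (fromEquivalence (returnsFrom-sound w) (returnsFrom-complete w))

height : Word → ℤ
height w = + count a w ℤ.- + count b w

count-snoc : ∀ c d u → count c (u ++ [ d ]) ≡ count c [ d ] ℕ.+ count c u
count-snoc a a [] = refl
count-snoc a b [] = refl
count-snoc b a [] = refl
count-snoc b b [] = refl
count-snoc a d (a ∷ u) = trans (cong suc (count-snoc a d u)) (sym (+-suc (count a [ d ]) (count a u)))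
count-snoc a d (b ∷ u) = count-snoc a d u
count-snoc b d (a ∷ u) = count-snoc b d u
count-snoc b d (b ∷ u) = trans (cong suc (count-snoc b d u)) (sym (+-suc (count b [ d ]) (count b u)))

height-snoc-a : ∀ u → height (u ++ [ a ]) ≡ ℤ.suc (height u)
height-snoc-a u = trans (cong₂ (λ m n → + m ℤ.- + n) (count-snoc a a u) (count-snoc b a u))
  (ℤₚ.+-assoc ℤ.1ℤ (+ count a u) (ℤ.- + count b u))

height-snoc-b : ∀ u → height (u ++ [ b ]) ≡ ℤ.pred (height u)
height-snoc-b u = trans (cong₂ (λ m n → + m ℤ.- + n) (count-snoc a b u) (count-snoc b b u))
  (lower (+ count a u) (+ count b u))
  where
  lower : ∀ m n → m ℤ.- (ℤ.1ℤ ℤ.+ n) ≡ ℤ.-1ℤ ℤ.+ (m ℤ.- n)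
  lower = solve-∀

endsWithA-snoc : ∀ u c → endsWithA (u ++ [ c ]) ≡ endsWithA [ c ]
endsWithA-snoc [] c = refl
endsWithA-snoc (a ∷ []) c = refl
endsWithA-snoc (b ∷ []) c = refl
endsWithA-snoc (a ∷ d ∷ u) c = endsWithA-snoc (d ∷ u) c
endsWithA-snoc (b ∷ d ∷ u) c = endsWithA-snoc (d ∷ u) c

module _ {c ℓ : Level} (R : CommutativeRing c ℓ) where

  open CommutativeRing R hiding (refl; sym; trans; zero)
  open CommutativeRing R using () renaming (refl to ≈-refl; sym to ≈-sym; trans to ≈-trans)
  open Poly R
  open import Relation.Binary.Reasoning.Setoid setoid
  open import Algebra.Properties.CommutativeSemigroup +-commutativeSemigroup using (interchange)
  open import Algebra.Properties.AbelianGroup +-abelianGroup using (xyx⁻¹≈y; ⁻¹-anti-homo-∙; ε⁻¹≈ε)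

  1+-[1+x]≈-x : ∀ x → 1# + - (1# + x) ≈ - x
  1+-[1+x]≈-x x = begin
    1# + - (1# + x)    ≈⟨ +-congˡ (⁻¹-anti-homo-∙ 1# x) ⟩
    1# + (- x + - 1#)  ≈⟨ ≈-sym (+-assoc _ _ _) ⟩
    1# + - x + - 1#    ≈⟨ xyx⁻¹≈y 1# (- x) ⟩
    - x                ∎

  intR-suc : ∀ i → intR (ℤ.suc i) ≈ 1# + intR i
  intR-suc (+ n) = ≈-refl
  intR-suc -[1+ zero ] = ≈-sym (≈-trans (1+-[1+x]≈-x 0#) ε⁻¹≈ε)
  intR-suc -[1+ suc n ] = ≈-sym (1+-[1+x]≈-x (natR (suc n)))

  weightFrom : Carrier → Carrier → Bool → ℤ → Word → Carrier
  weightFrom x y afterA h [] = 1#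
  weightFrom x y afterA h (a ∷ w) = weightFrom x y true (ℤ.suc h) w
  weightFrom x y afterA h (b ∷ w) = (if afterA then x else y + intR (ℤ.pred h)) * weightFrom x y false (ℤ.pred h) w

  Lgo≡weightFrom : ∀ x y pre w → Lgo x y pre w ≡ weightFrom x y (endsWithA pre) (height pre) w
  Lgo≡weightFrom x y pre [] = refl
  Lgo≡weightFrom x y pre (a ∷ w) = trans (Lgo≡weightFrom x y (pre ++ [ a ]) w)
    (cong₂ (λ e h → weightFrom x y e h w) (endsWithA-snoc pre a) (height-snoc-a pre))
  Lgo≡weightFrom x y pre (b ∷ w) = cong₂ _*_
    (cong (λ h → if endsWithA pre then x else y + intR h) (height-snoc-b pre))
    (trans (Lgo≡weightFrom x y (pre ++ [ b ]) w)
      (cong₂ (λ e h → weightFrom x y e h w) (endsWithA-snoc pre b) (height-snoc-b pre)))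

  weightFrom-shift : ∀ x y e i w → weightFrom x y e (ℤ.suc i) w ≈ weightFrom x (y + 1#) e i w
  weightFrom-shift x y e i [] = ≈-refl
  weightFrom-shift x y e i (a ∷ w) = weightFrom-shift x y true (ℤ.suc i) w
  weightFrom-shift x y e i (b ∷ w) rewrite ℤₚ.pred-suc i = *-cong (factor-shift e) rest-shift
    where
    factor-shift : ∀ e → (if e then x else y + intR i) ≈ (if e then x else (y + 1#) + intR (ℤ.pred i))
    factor-shift true = ≈-refl
    factor-shift false = begin
      y + intR i                   ≡⟨ cong (λ j → y + intR j) (sym (ℤₚ.suc-pred i)) ⟩
      y + intR (ℤ.suc (ℤ.pred i))  ≈⟨ +-congˡ (intR-suc (ℤ.pred i)) ⟩
      y + (1# + intR (ℤ.pred i))   ≈⟨ ≈-sym (+-assoc _ _ _) ⟩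
      (y + 1#) + intR (ℤ.pred i)   ∎
    rest-shift : weightFrom x y false i w ≈ weightFrom x (y + 1#) false (ℤ.pred i) w
    rest-shift = ≈-trans (reflexive (cong (λ j → weightFrom x y false j w) (sym (ℤₚ.suc-pred i))))
                         (weightFrom-shift x y false (ℤ.pred i) w)

  weightFrom-snoc-b : ∀ x y e h c u → T (dyckFrom h (c ∷ u)) →
    weightFrom x y e (+ suc h) ((c ∷ u) ++ [ b ]) ≈ weightFrom x y e (+ suc h) (c ∷ u) * y
  weightFrom-snoc-b x y e h a (c ∷ u) d = weightFrom-snoc-b x y true (suc h) c u d
  weightFrom-snoc-b x y e (suc zero) b [] d = ≈-trans (*-congˡ (≈-trans (*-identityʳ _) (+-identityʳ y)))
                                                      (*-congʳ (≈-sym (*-identityʳ _)))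
  weightFrom-snoc-b x y e (suc h) b (c ∷ u) d = ≈-trans (*-congˡ (weightFrom-snoc-b x y false h c u d))
                                                       (≈-sym (*-assoc _ _ _))

  0*x+y≈y : ∀ x y → 0# * x + y ≈ y
  0*x+y≈y x y = ≈-trans (+-congʳ (zeroˡ x)) (+-identityˡ y)

  when : Bool → Carrier → Carrier
  when e v = if e then v else 0#

  when-cong : ∀ e {u v} → (T e → u ≈ v) → when e u ≈ when e v
  when-cong true h = h _
  when-cong false h = ≈-refl

  when-false : ∀ e {v} → ¬ T e → when e v ≈ 0#
  when-false true h = ⊥-elim (h _)
  when-false false h = ≈-refl

  when-*ˡ : ∀ e k v → when e (k * v) ≈ k * when e v
  when-*ˡ true k v = ≈-refl
  when-*ˡ false k v = ≈-sym (zeroʳ k)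

  sumWords : ℕ → (Word → Carrier) → Carrier
  sumWords zero f = f []
  sumWords (suc m) f = sumWords m (λ w → f (a ∷ w) + f (b ∷ w))

  sumWords-cong : ∀ m {f g} → (∀ w → length w ≡ m → f w ≈ g w) → sumWords m f ≈ sumWords m g
  sumWords-cong zero h = h [] refl
  sumWords-cong (suc m) h = sumWords-cong m (λ w ℓ → +-cong (h (a ∷ w) (cong suc ℓ)) (h (b ∷ w) (cong suc ℓ)))

  sumWords-zero : ∀ m → sumWords m (λ _ → 0#) ≈ 0#
  sumWords-zero zero = ≈-refl
  sumWords-zero (suc m) = ≈-trans (sumWords-cong m (λ _ _ → +-identityˡ 0#)) (sumWords-zero m)

  sumWords-+ : ∀ m f g → sumWords m (λ w → f w + g w) ≈ sumWords m f + sumWords m g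
  sumWords-+ zero f g = ≈-refl
  sumWords-+ (suc m) f g = ≈-trans (sumWords-cong m (λ _ _ → interchange _ _ _ _)) (sumWords-+ m _ _)

  sumWords-*ˡ : ∀ m k f → sumWords m (λ w → k * f w) ≈ k * sumWords m f
  sumWords-*ˡ zero k f = ≈-refl
  sumWords-*ˡ (suc m) k f = ≈-trans (sumWords-cong m (λ _ _ → ≈-sym (distribˡ k _ _))) (sumWords-*ˡ m k _)

  sumWords-*ʳ : ∀ m k f → sumWords m (λ w → f w * k) ≈ sumWords m f * k
  sumWords-*ʳ m k f = ≈-trans (sumWords-cong m (λ _ _ → *-comm _ _)) (≈-trans (sumWords-*ˡ m k f) (*-comm _ _))

  sumWords-snoc : ∀ m f → sumWords (suc m) f ≈ sumWords m (λ u → f (u ++ [ a ]) + f (u ++ [ b ]))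
  sumWords-snoc zero f = ≈-refl
  sumWords-snoc (suc m) f =
    ≈-trans (sumWords-snoc m (λ w → f (a ∷ w) + f (b ∷ w))) (sumWords-cong m (λ _ _ → interchange _ _ _ _))

  sumWords-product : ∀ m n f g → sumWords m (λ u → sumWords n (λ v → f u * g v)) ≈ sumWords m f * sumWords n g
  sumWords-product m n f g = ≈-trans (sumWords-cong m (λ u _ → sumWords-*ˡ n (f u) g)) (sumWords-*ʳ m _ f)

  sumSplits : (Word → Word → Carrier) → Word → Carrier
  sumSplits g [] = g [] []
  sumSplits g (c ∷ w) = g [] (c ∷ w) + sumSplits (λ u v → g (c ∷ u) v) w

  sumSplits-cong : ∀ {g h} w → (∀ u v → g u v ≈ h u v) → sumSplits g w ≈ sumSplits h w
  sumSplits-cong [] e = e [] []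
  sumSplits-cong (c ∷ w) e = +-cong (e [] (c ∷ w)) (sumSplits-cong w (λ u v → e (c ∷ u) v))

  sumSplits-zero : ∀ {g} w → (∀ u v → g u v ≈ 0#) → sumSplits g w ≈ 0#
  sumSplits-zero [] e = e [] []
  sumSplits-zero (c ∷ w) e =
    ≈-trans (+-cong (e [] (c ∷ w)) (sumSplits-zero w (λ u v → e (c ∷ u) v))) (+-identityˡ 0#)

  sumSplits-*ˡ : ∀ k g w → sumSplits (λ u v → k * g u v) w ≈ k * sumSplits g w
  sumSplits-*ˡ k g [] = ≈-refl
  sumSplits-*ˡ k g (c ∷ w) = ≈-trans (+-congˡ (sumSplits-*ˡ k _ w)) (≈-sym (distribˡ k _ _))

  sumSplits-null : ∀ (f g : Word → Carrier) w → sumSplits (λ u v → when (null u) (f u) * g v) w ≈ f [] * g w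
  sumSplits-null f g [] = ≈-refl
  sumSplits-null f g (c ∷ w) = ≈-trans (+-congˡ (sumSplits-zero w (λ u v → zeroˡ (g v)))) (+-identityʳ _)

  sumBelow : ℕ → (ℕ → Carrier) → Carrier
  sumBelow n F = sumR (applyUpTo F n)

  sumBelow-cong : ∀ n {F G} → (∀ k → F k ≈ G k) → sumBelow n F ≈ sumBelow n G
  sumBelow-cong zero e = ≈-refl
  sumBelow-cong (suc n) e = +-cong (e 0) (sumBelow-cong n (e ∘ suc))

  sumBelow-+ : ∀ n F G → sumBelow n (λ k → F k + G k) ≈ sumBelow n F + sumBelow n G
  sumBelow-+ zero F G = ≈-sym (+-identityˡ 0#)
  sumBelow-+ (suc n) F G = ≈-trans (+-congˡ (sumBelow-+ n (F ∘ suc) (G ∘ suc))) (interchange _ _ _ _)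

  sumBelow-suc : ∀ n F → sumBelow (suc n) F ≈ sumBelow n F + F n
  sumBelow-suc zero F = +-comm _ _
  sumBelow-suc (suc n) F = ≈-trans (+-congˡ (sumBelow-suc n (F ∘ suc))) (≈-sym (+-assoc _ _ _))

  sumBelow-double : ∀ n F → (∀ j → F (suc (double j)) ≈ 0#) →
    sumBelow (suc (double n)) F ≈ sumBelow (suc n) (F ∘ double)
  sumBelow-double zero F odd = ≈-refl
  sumBelow-double (suc n) F odd = +-congˡ (≈-trans (+-congʳ (odd 0))
    (≈-trans (+-identityˡ _) (sumBelow-double n (F ∘ suc ∘ suc) (odd ∘ suc))))

  sumBelow-ends : ∀ n F → F 0 ≈ 0# → sumBelow (suc (suc n)) F ≈ F (suc n) + sumFrom1 n F
  sumBelow-ends n F F0 = begin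
    F 0 + sumBelow (suc n) (F ∘ suc)  ≈⟨ ≈-trans (+-congʳ F0) (+-identityˡ _) ⟩
    sumBelow (suc n) (F ∘ suc)        ≈⟨ ≈-trans (sumBelow-suc n (F ∘ suc)) (+-comm _ _) ⟩
    F (suc n) + sumBelow n (F ∘ suc)  ≡⟨ cong (λ xs → F (suc n) + sumR xs) (sym (map-upTo (F ∘ suc) n)) ⟩
    F (suc n) + sumFrom1 n F          ∎

  sumWords-sumSplits : ∀ m g →
    sumWords m (sumSplits g) ≈ sumBelow (suc m) (λ k → sumWords k (λ u → sumWords (m ∸ k) (g u)))
  sumWords-sumSplits zero g = ≈-sym (+-identityʳ _)
  sumWords-sumSplits (suc m) g = begin
    sumWords m (λ w → sumSplits g (a ∷ w) + sumSplits g (b ∷ w))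
      ≈⟨ sumWords-cong m (λ _ _ → interchange _ _ _ _) ⟩
    sumWords m (λ w → (g [] (a ∷ w) + g [] (b ∷ w)) + (sumSplits ga w + sumSplits gb w))
      ≈⟨ ≈-trans (sumWords-+ m _ _) (+-congˡ (sumWords-+ m _ _)) ⟩
    sumWords (suc m) (g []) + (sumWords m (sumSplits ga) + sumWords m (sumSplits gb))
      ≈⟨ +-congˡ (+-cong (sumWords-sumSplits m ga) (sumWords-sumSplits m gb)) ⟩
    sumWords (suc m) (g []) + (sumBelow (suc m) (split ga) + sumBelow (suc m) (split gb))
      ≈⟨ +-congˡ (≈-sym (sumBelow-+ (suc m) (split ga) (split gb))) ⟩
    sumWords (suc m) (g []) + sumBelow (suc m) (λ k → split ga k + split gb k)
      ≈⟨ +-congˡ (sumBelow-cong (suc m) (λ k → ≈-sym (sumWords-+ k (λ u → sumWords (m ∸ k) (ga u))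
                                                                   (λ u → sumWords (m ∸ k) (gb u))))) ⟩
    sumWords (suc m) (g []) + sumBelow (suc m) (λ k → sumWords (suc k) (λ u → sumWords (m ∸ k) (g u)))
      ∎
    where
    ga gb : Word → Word → Carrier
    ga u = g (a ∷ u)
    gb u = g (b ∷ u)
    split : (Word → Word → Carrier) → ℕ → Carrier
    split h k = sumWords k (λ u → sumWords (m ∸ k) (h u))

  sum-filter : ∀ {P : Word → Set} (P? : Decidable P) f ws →
    sumR (map f (filter P? ws)) ≈ sumR (map (λ w → when (does (P? w)) (f w)) ws)
  sum-filter P? f [] = ≈-refl
  sum-filter P? f (w ∷ ws) with does (P? w)
  ... | true = +-congˡ (sum-filter P? f ws)
  ... | false = ≈-trans (sum-filter P? f ws) (≈-sym (+-identityˡ _))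

  sum-words : ∀ m f → sumR (map f (words m)) ≈ sumWords m f
  sum-words zero f = +-identityʳ _
  sum-words (suc m) f = ≈-trans (sum-pairs (words m)) (sum-words m (λ w → f (a ∷ w) + f (b ∷ w)))
    where
    sum-pairs : ∀ ws → sumR (map f (concatMap (λ w → (a ∷ w) ∷ (b ∷ w) ∷ []) ws))
                       ≈ sumR (map (λ w → f (a ∷ w) + f (b ∷ w)) ws)
    sum-pairs [] = ≈-refl
    sum-pairs (w ∷ ws) = ≈-trans (+-congˡ (+-congˡ (sum-pairs ws))) (≈-sym (+-assoc _ _ _))

  sumWeights-filter : ∀ {P : Word → Set} (P? : Decidable P) (χ : Word → Bool) → (∀ w → does (P? w) ≡ χ w) →
    ∀ n x y → sumR (map (λ w → Lw w x y) (filter P? (words (2 ℕ.* n))))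
              ≈ sumWords (double n) (λ w → when (χ w) (weightFrom x y false (+ 0) w))
  sumWeights-filter P? χ does≡χ n x y = begin
    sumR (map (λ w → Lw w x y) (filter P? (words (2 ℕ.* n))))
      ≈⟨ sum-filter P? (λ w → Lw w x y) (words (2 ℕ.* n)) ⟩
    sumR (map (λ w → when (does (P? w)) (Lw w x y)) (words (2 ℕ.* n)))
      ≈⟨ sum-words (2 ℕ.* n) _ ⟩
    sumWords (2 ℕ.* n) (λ w → when (does (P? w)) (Lw w x y))
      ≡⟨ cong (λ m → sumWords m (λ w → when (does (P? w)) (Lw w x y))) (sym (double≡2* n)) ⟩
    sumWords (double n) (λ w → when (does (P? w)) (Lw w x y))
      ≈⟨ sumWords-cong (double n) (λ w _ → reflexive (cong₂ when (does≡χ w) (Lgo≡weightFrom x y [] w))) ⟩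
    sumWords (double n) (λ w → when (χ w) (weightFrom x y false (+ 0) w)) ∎

  dyckTerm primitiveTerm : Carrier → Carrier → Word → Carrier
  dyckTerm x y w = when (dyckFrom 0 w) (weightFrom x y false (+ 0) w)
  primitiveTerm x y w = when (returnsFrom 0 w) (weightFrom x y false (+ 0) w)

  L-as-sum : ∀ n x y → L n x y ≈ sumWords (double n) (dyckTerm x y)
  L-as-sum = sumWeights-filter isDyck? (dyckFrom 0) does-isDyck?

  L'-as-sum : ∀ n x y → L' n x y ≈ sumWords (double n) (primitiveTerm x y)
  L'-as-sum = sumWeights-filter isPrimitive? (returnsFrom 0) does-isPrimitive?

  primitiveTerm-frame : ∀ x y u →
    (primitiveTerm x y (a ∷ u ++ [ a ]) + primitiveTerm x y (b ∷ u ++ [ a ]))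
      + (primitiveTerm x y (a ∷ u ++ [ b ]) + primitiveTerm x y (b ∷ u ++ [ b ]))
    ≈ primitiveTerm x y (a ∷ u ++ [ b ])
  primitiveTerm-frame x y u rewrite returnsFrom-snoc-a 1 u =
    ≈-trans (+-congʳ (+-identityˡ 0#)) (≈-trans (+-identityˡ _) (+-identityʳ _))

  primitiveTerm-wrap : ∀ x y c u → primitiveTerm x y (a ∷ (c ∷ u) ++ [ b ]) ≈ y * dyckTerm x (y + 1#) (c ∷ u)
  primitiveTerm-wrap x y c u rewrite returnsFrom-snoc-b 0 (c ∷ u) =
    ≈-trans (when-cong (dyckFrom 0 (c ∷ u)) (wrap c)) (when-*ˡ (dyckFrom 0 (c ∷ u)) y _)
    where
    wrap : ∀ c → T (dyckFrom 0 (c ∷ u)) →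
      weightFrom x y true (+ 1) ((c ∷ u) ++ [ b ]) ≈ y * weightFrom x (y + 1#) false (+ 0) (c ∷ u)
    wrap a d = begin
      weightFrom x y true (+ 1) ((a ∷ u) ++ [ b ])  ≈⟨ weightFrom-snoc-b x y true 0 a u d ⟩
      weightFrom x y true (+ 1) (a ∷ u) * y          ≈⟨ *-congʳ (weightFrom-shift x y true (+ 0) (a ∷ u)) ⟩
      weightFrom x (y + 1#) true (+ 0) (a ∷ u) * y   ≈⟨ *-comm _ y ⟩
      y * weightFrom x (y + 1#) false (+ 0) (a ∷ u)  ∎

  L'-via-L : ∀ n x y → L' (suc (suc n)) x y ≈ y * L (suc n) x (y + 1#)
  L'-via-L n x y = begin
    L' (suc (suc n)) x y
      ≈⟨ L'-as-sum (suc (suc n)) x y ⟩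
    sumWords (suc m) (λ w → prim (a ∷ w) + prim (b ∷ w))
      ≈⟨ sumWords-snoc m (λ w → prim (a ∷ w) + prim (b ∷ w)) ⟩
    sumWords m (λ u → (prim (a ∷ u ++ [ a ]) + prim (b ∷ u ++ [ a ]))
                      + (prim (a ∷ u ++ [ b ]) + prim (b ∷ u ++ [ b ])))
      ≈⟨ sumWords-cong m (λ u _ → primitiveTerm-frame x y u) ⟩
    sumWords m (λ u → prim (a ∷ u ++ [ b ]))
      ≈⟨ sumWords-cong m {g = λ u → y * dyck u} wrap ⟩
    sumWords m (λ u → y * dyck u)
      ≈⟨ sumWords-*ˡ m y dyck ⟩
    y * sumWords m dyck
      ≈⟨ *-congˡ (≈-sym (L-as-sum (suc n) x (y + 1#))) ⟩
    y * L (suc n) x (y + 1#) ∎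
    where
    m : ℕ
    m = double (suc n)
    prim dyck : Word → Carrier
    prim = primitiveTerm x y
    dyck = dyckTerm x (y + 1#)
    wrap : ∀ u → length u ≡ m → prim (a ∷ u ++ [ b ]) ≈ y * dyck u
    wrap (c ∷ u) _ = primitiveTerm-wrap x y c u

  weightFrom-firstReturn : ∀ x y k e w →
    when (dyckFrom (suc k) w) (weightFrom x y e (+ suc k) w)
      ≈ sumSplits (λ u v → when (returnsFrom (suc k) u) (weightFrom x y e (+ suc k) u) * dyckTerm x y v) w
  weightFrom-firstReturn x y k e [] = ≈-sym (zeroˡ _)
  weightFrom-firstReturn x y k e (a ∷ w) =
    ≈-trans (weightFrom-firstReturn x y (suc k) true w) (≈-sym (0*x+y≈y _ _))
  weightFrom-firstReturn x y zero e (b ∷ w) = begin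
    when (dyckFrom 0 w) (f * weightFrom x y false (+ 0) w)
      ≈⟨ when-*ˡ (dyckFrom 0 w) f _ ⟩
    f * dyckTerm x y w
      ≈⟨ *-congʳ (≈-sym (*-identityʳ f)) ⟩
    (f * 1#) * dyckTerm x y w
      ≈⟨ ≈-sym (sumSplits-null (λ u → f * weightFrom x y false (+ 0) u) (dyckTerm x y) w) ⟩
    sumSplits (λ u v → when (null u) (f * weightFrom x y false (+ 0) u) * dyckTerm x y v) w
      ≈⟨ ≈-sym (0*x+y≈y _ _) ⟩
    sumSplits (λ u v → when (returnsFrom 1 u) (weightFrom x y e (+ 1) u) * dyckTerm x y v) (b ∷ w) ∎
    where
    f : Carrier
    f = if e then x else y + intR (ℤ.pred (+ 1))
  weightFrom-firstReturn x y (suc k) e (b ∷ w) = begin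
    when (dyckFrom (suc k) w) (f * weightFrom x y false (+ suc k) w)
      ≈⟨ when-*ˡ (dyckFrom (suc k) w) f _ ⟩
    f * when (dyckFrom (suc k) w) (weightFrom x y false (+ suc k) w)
      ≈⟨ *-congˡ (weightFrom-firstReturn x y k false w) ⟩
    f * sumSplits (λ u v → when (returnsFrom (suc k) u) (weightFrom x y false (+ suc k) u) * dyckTerm x y v) w
      ≈⟨ ≈-sym (sumSplits-*ˡ f _ w) ⟩
    sumSplits (λ u v → f * (when (returnsFrom (suc k) u) (weightFrom x y false (+ suc k) u) * dyckTerm x y v)) w
      ≈⟨ sumSplits-cong w (λ u v → ≈-trans (≈-sym (*-assoc _ _ _))
                                           (*-congʳ (≈-sym (when-*ˡ (returnsFrom (suc k) u) f _)))) ⟩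
    sumSplits (λ u v → when (returnsFrom (suc k) u) (f * weightFrom x y false (+ suc k) u) * dyckTerm x y v) w
      ≈⟨ ≈-sym (0*x+y≈y _ _) ⟩
    sumSplits (λ u v → when (returnsFrom (suc (suc k)) u) (weightFrom x y e (+ suc (suc k)) u) * dyckTerm x y v)
              (b ∷ w) ∎
    where
    f : Carrier
    f = if e then x else y + intR (ℤ.pred (+ suc (suc k)))

  dyckTerm-firstReturn : ∀ x y c w →
    dyckTerm x y (c ∷ w) ≈ sumSplits (λ u v → primitiveTerm x y u * dyckTerm x y v) (c ∷ w)
  dyckTerm-firstReturn x y a w =
    ≈-trans (weightFrom-firstReturn x y 0 true w) (≈-sym (0*x+y≈y _ _))
  dyckTerm-firstReturn x y b w =
    ≈-sym (≈-trans (0*x+y≈y _ _) (sumSplits-zero w (λ u v → zeroˡ _)))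

  sumWords-primitiveTerm-odd : ∀ x y j → sumWords (suc (double j)) (primitiveTerm x y) ≈ 0#
  sumWords-primitiveTerm-odd x y j =
    ≈-trans (sumWords-cong (suc (double j)) {g = λ _ → 0#} odd) (sumWords-zero (suc (double j)))
    where
    odd : ∀ u → length u ≡ suc (double j) → primitiveTerm x y u ≈ 0#
    odd u ℓ = when-false (returnsFrom 0 u) (returnsFrom-odd j u ℓ)

  L-via-L' : ∀ n x y → L (suc n) x y ≈ L' (suc n) x y + sumFrom1 n (λ p → L' p x y * L (suc n ∸ p) x y)
  L-via-L' n x y = begin
    L N x y
      ≈⟨ L-as-sum N x y ⟩
    sumWords (double N) dyck
      ≈⟨ sumWords-cong (double N) decompose ⟩
    sumWords (double N) (sumSplits (λ u v → prim u * dyck v))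
      ≈⟨ sumWords-sumSplits (double N) (λ u v → prim u * dyck v) ⟩
    sumBelow (suc (double N)) (λ k → sumWords k (λ u → sumWords (double N ∸ k) (λ v → prim u * dyck v)))
      ≈⟨ sumBelow-cong (suc (double N)) (λ k → sumWords-product k (double N ∸ k) prim dyck) ⟩
    sumBelow (suc (double N)) F
      ≈⟨ sumBelow-double N F (λ j → ≈-trans (*-congʳ (sumWords-primitiveTerm-odd x y j)) (zeroˡ _)) ⟩
    sumBelow (suc N) (F ∘ double)
      ≈⟨ sumBelow-cong (suc N) F-double ⟩
    sumBelow (suc N) H
      ≈⟨ sumBelow-ends n H (≈-trans (*-congʳ (L'-as-sum 0 x y)) (zeroˡ _)) ⟩
    L' N x y * L (N ∸ N) x y + sumFrom1 n H
      ≈⟨ +-congʳ (≈-trans (*-congˡ L[N∸N]≈1) (*-identityʳ _)) ⟩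
    L' N x y + sumFrom1 n H ∎
    where
    N : ℕ
    N = suc n
    prim dyck : Word → Carrier
    prim = primitiveTerm x y
    dyck = dyckTerm x y
    decompose : ∀ w → length w ≡ double N → dyck w ≈ sumSplits (λ u v → prim u * dyck v) w
    decompose (c ∷ w) _ = dyckTerm-firstReturn x y c w
    F H : ℕ → Carrier
    F k = sumWords k prim * sumWords (double N ∸ k) dyck
    H p = L' p x y * L (N ∸ p) x y
    F-double : ∀ p → F (double p) ≈ H p
    F-double p = *-cong (≈-sym (L'-as-sum p x y))
      (≈-trans (reflexive (cong (λ m → sumWords m dyck) (double-∸ N p))) (≈-sym (L-as-sum (N ∸ p) x y)))
    L[N∸N]≈1 : L (N ∸ N) x y ≈ 1#
    L[N∸N]≈1 = ≈-trans (reflexive (cong (λ m → L m x y) (n∸n≡0 N))) (L-as-sum 0 x y)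

proposition6 : ∀ {c ℓ : Level} (R : CommutativeRing c ℓ) (n : ℕ) → 1 < n →
    (x y : CommutativeRing.Carrier R) →
    let open CommutativeRing R
        open Poly R
    in (L' n x y ≈ y * L (n ∸ 1) x (y + 1#))
       × (L n x y ≈ L' n x y + sumFrom1 (n ∸ 1) (λ p → L' p x y * L (n ∸ p) x y))
proposition6 R (suc (suc n)) (s≤s (s≤s _)) x y = L'-via-L R n x y , L-via-L' R (suc n) x y
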